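{- Let $r=r_1r_2\cdots r_n$ be the row reading word of a standard tableau $P$. (1) It is impossible to perform a $K_2^+$ move on $r$. (2) Suppose one can perform a $K_2^-$ move $zxy\mapsto xzy$ (with $x<y<z$) on $r$ which is not a $K_B$ move. If $r_1\neq z$, then $r=r_1\cdots r_\ell\,z\,x\,y\cdots r_n$ with $r_1>r_2>\cdots>r_\ell>z$; and the tableau $P$ has the following form: the entry $z$ is alone in its row, the row immediately above the row of $z$ begins with the entries $x,y$ (possibly followed by further entries), and the rows below the row of $z$ are the single entries $r_\ell,\dots,r_1$ (from top to bottom).
   Context: Tableaux are in English notation; the row reading word of a tableau is the concatenation of its rows from bottom to top, each read left to right. Knuth moves, with $x<y<z$: a $K_2$ move exchanges a consecutive pattern $xzy$ with $zxy$; it is denoted $K_2^+$ when it replaces $xzy$ by $zxy$ (an "$xz$" pattern by a "$zx$" pattern) and $K_2^-$ when it replaces $zxy$ by $xzy$. A $K_B$ move exchanges consecutive $y_1xzy_2$ and $y_1zxy_2$ where $x<y_1<z$ and $x<y_2<z$. -}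

module Defs where

open import Data.Nat using (ℕ; suc; _<_; _>_)
open import Data.List using (List; []; _∷_; _++_; concat; reverse; map; length; upTo)
open import Data.List.Relation.Unary.All using (All)
open import Data.List.Relation.Unary.Linked using (Linked)
open import Data.List.Relation.Binary.Permutation.Propositional using (_↭_)
open import Data.Product using (Σ; ∃; _×_; _,_)
open import Data.Sum using (_⊎_)
open import Data.Unit using (⊤)
open import Data.Empty using (⊥)
open import Relation.Binary.PropositionalEquality using (_≡_)
open import Relation.Nullary using (¬_)

-- A tableau (English notation) is a list of rows, top row first.
Tableau : Set
Tableau = List (List ℕ)

NonEmpty : List ℕ → Set
NonEmpty [] = ⊥
NonEmpty (_ ∷ _) = ⊤

-- `Below upper lower` : row `lower` sits directly below row `upper`:
-- it is no longer, and entries increase strictly down each column.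
Below : List ℕ → List ℕ → Set
Below _ [] = ⊤
Below [] (_ ∷ _) = ⊥
Below (a ∷ as) (b ∷ bs) = (a < b) × Below as bs

-- consecutive rows satisfy `Below` (hence shape is a partition, columns increase)
ColumnStrict : Tableau → Set
ColumnStrict [] = ⊤
ColumnStrict (_ ∷ []) = ⊤
ColumnStrict (R ∷ R' ∷ Rs) = Below R R' × ColumnStrict (R' ∷ Rs)

StandardTableau : Tableau → Set
StandardTableau P =
  All NonEmpty P × All (Linked _<_) P × ColumnStrict P ×
  (concat P ↭ map suc (upTo (length (concat P))))

rowWord : Tableau → List ℕ
rowWord P = concat (reverse P)

K2plus : List ℕ → List ℕ → Set
K2plus u v = ∃ λ pre → ∃ λ suf → ∃ λ x → ∃ λ y → ∃ λ z →
  x < y × y < z ×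
  u ≡ pre ++ x ∷ z ∷ y ∷ suf × v ≡ pre ++ z ∷ x ∷ y ∷ suf

K2minus : List ℕ → List ℕ → Set
K2minus u v = ∃ λ pre → ∃ λ suf → ∃ λ x → ∃ λ y → ∃ λ z →
  x < y × y < z ×
  u ≡ pre ++ z ∷ x ∷ y ∷ suf × v ≡ pre ++ x ∷ z ∷ y ∷ suf

KB : List ℕ → List ℕ → Set
KB u v = ∃ λ pre → ∃ λ suf → ∃ λ y₁ → ∃ λ x → ∃ λ z → ∃ λ y₂ →
  x < y₁ × y₁ < z × x < y₂ × y₂ < z ×
  ((u ≡ pre ++ y₁ ∷ x ∷ z ∷ y₂ ∷ suf × v ≡ pre ++ y₁ ∷ z ∷ x ∷ y₂ ∷ suf) ⊎
   (u ≡ pre ++ y₁ ∷ z ∷ x ∷ y₂ ∷ suf × v ≡ pre ++ y₁ ∷ x ∷ z ∷ y₂ ∷ suf))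

singletonRow : ℕ → List ℕ
singletonRow a = a ∷ []

{-# OPTIONS --safe #-}
module Submission where

-- In the reading word of a tableau a descent can only occur at a row break, and
-- the letter after it begins a row, so it is smaller than every earlier letter
-- (first columns decrease upwards and each row starts with its minimum). Hence
-- in x z y the descent z y would force y < x: no K₂⁺ move exists. In z x y the
-- letter x begins the row above the row of z, and y follows it in that row. A
-- letter w just before z in its row would satisfy x < w < z and give a K_B move,
-- so z is alone in its row, and the rows below a one-box row are one-box rows.

open import Defs
open import Level using (Level)
open import Data.Nat using (ℕ; _<_; _>_)
open import Data.Nat.Properties using (<-trans; <-asym)
open import Data.List using (List; []; _∷_; _++_; _∷ʳ_; reverse; reverseAcc; _ʳ++_; map; head; concat; initLast; _∷ʳ′_)
open import Data.List.Properties using (∷-injective; ++-assoc; reverse-++; ʳ++-defn; reverse-map; reverse-involutive)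
open import Data.List.Relation.Unary.All as All using (All; [] ; _∷_)
open import Data.List.Relation.Unary.All.Properties using (++⁺; ++⁻ˡ; ++⁻ʳ; ∷ʳ⁻)
open import Data.List.Relation.Unary.Linked using (Linked; [-]; _∷_)
open import Data.List.Relation.Unary.Linked.Properties using (Linked⇒All)
open import Data.Maybe using (just)
open import Data.Product using (∃; ∃₂; _×_; _,_; proj₂)
open import Data.Sum using (_⊎_; inj₁; inj₂)
open import Data.Empty using (⊥; ⊥-elim)
open import Data.Unit using (⊤; tt)
open import Relation.Binary.Core using (Rel)
open import Relation.Binary.PropositionalEquality using (_≡_; _≢_; refl; sym; trans; cong; subst; module ≡-Reasoning)
open import Relation.Nullary using (¬_)

private
  variable
    a ℓ : Level
    A : Set a

++-split : ∀ (xs ys us : List A) {c} vs → xs ++ ys ≡ us ++ c ∷ vs →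
  (∃ λ m → us ≡ xs ++ m × ys ≡ m ++ c ∷ vs) ⊎ (∃ λ m → xs ≡ us ++ c ∷ m × vs ≡ m ++ ys)
++-split []       ys us       vs eq   = inj₁ (us , refl , eq)
++-split (x ∷ xs) ys []       vs refl = inj₂ (xs , refl , refl)
++-split (x ∷ xs) ys (u ∷ us) vs eq with ∷-injective eq
... | refl , eq′ with ++-split xs ys us vs eq′
...   | inj₁ (m , eq₁ , eq₂) = inj₁ (m , cong (x ∷_) eq₁ , eq₂)
...   | inj₂ (m , eq₁ , eq₂) = inj₂ (m , cong (x ∷_) eq₁ , eq₂)

Linked-adjacent : ∀ {R : Rel A ℓ} pre {x y} r → Linked R (pre ++ x ∷ y ∷ r) → R x y
Linked-adjacent []            r (Rxy ∷ _) = Rxy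
Linked-adjacent (_ ∷ [])      r (_ ∷ Rs)  = Linked-adjacent [] r Rs
Linked-adjacent (_ ∷ p ∷ pre) r (_ ∷ Rs)  = Linked-adjacent (p ∷ pre) r Rs

-- The rows of a tableau listed from the bottom up, so that the row reading
-- word is their concatenation.
BelowFirst : List (List ℕ) → List ℕ → Set
BelowFirst []      L = ⊤
BelowFirst (U ∷ _) L = Below U L

TableauFromBottom : List (List ℕ) → Set
TableauFromBottom []       = ⊤
TableauFromBottom (L ∷ Qs) =
  NonEmpty L × Linked _<_ L × BelowFirst Qs L × TableauFromBottom Qs

reverseAcc-tableau : ∀ R Ps acc → TableauFromBottom (R ∷ acc) →
  ColumnStrict (R ∷ Ps) → All NonEmpty Ps → All (Linked _<_) Ps →
  TableauFromBottom (reverseAcc (R ∷ acc) Ps)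
reverseAcc-tableau R []        acc t _          _          _          = t
reverseAcc-tableau R (R′ ∷ Ps) acc t (below , c) (ne ∷ nes) (lk ∷ lks) =
  reverseAcc-tableau R′ Ps (R ∷ acc) (ne , lk , below , t) c nes lks

reverse-tableau : ∀ P → StandardTableau P → TableauFromBottom (reverse P)
reverse-tableau []       _                            = tt
reverse-tableau (R ∷ Ps) (ne ∷ nes , lk ∷ lks , c , _) =
  reverseAcc-tableau R Ps [] (ne , lk , tt , tt) c nes lks

above<first : ∀ {l ls Qs c r} → TableauFromBottom ((l ∷ ls) ∷ Qs) →
  concat Qs ≡ c ∷ r → c < l
above<first {Qs = []}              _                     ()
above<first {Qs = [] ∷ _}          (_ , _ , _ , () , _)  _
above<first {Qs = (u ∷ _) ∷ _}     (_ , _ , (u<l , _) , _) refl = u<l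

below-singleton : ∀ {h l ls} → Below (h ∷ []) (l ∷ ls) → ls ≡ [] × h < l
below-singleton {ls = []}    (h<l , _) = refl , h<l
below-singleton {ls = _ ∷ _} (_ , ())

descent⇒<-prefix : ∀ Q pre {x y} suf → TableauFromBottom Q →
  concat Q ≡ pre ++ x ∷ y ∷ suf → y < x → All (y <_) pre
descent⇒<-prefix []               []      suf _ () _
descent⇒<-prefix []               (_ ∷ _) suf _ () _
descent⇒<-prefix ([] ∷ Qs)        pre     suf (() , _) _ _
descent⇒<-prefix ((l ∷ ls) ∷ Qs) pre {y = y} suf t@(_ , lk , _ , tQs) eq y<x
  with ++-split (l ∷ ls) (concat Qs) pre (y ∷ suf) eq
... | inj₁ ([] , refl , eq′) =
  ++⁺ (Linked⇒All <-trans (<-trans y<x (above<first t eq′)) lk) []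
... | inj₁ (c ∷ m , refl , eq′) =
  ++⁺ (Linked⇒All <-trans (<-trans (All.head ih) (above<first t eq′)) lk) ih
  where ih = descent⇒<-prefix Qs (c ∷ m) suf tQs eq′ y<x
... | inj₂ ([] , eq₁ , eq₂) =
  ++⁻ˡ pre (subst (All (y <_)) eq₁ (Linked⇒All <-trans (above<first t (sym eq₂)) lk))
... | inj₂ (c ∷ m , eq₁ , eq₂) with ∷-injective eq₂
...   | refl , _ = ⊥-elim (<-asym y<x (Linked-adjacent pre m (subst (Linked _<_) eq₁ lk)))

no-xzy : ∀ Q pre suf {x y z} → TableauFromBottom Q → x < y → y < z →
  concat Q ≢ pre ++ x ∷ z ∷ y ∷ suf
no-xzy Q pre suf {x} t x<y y<z eq =
  <-asym x<y (proj₂ (∷ʳ⁻ (descent⇒<-prefix Q (pre ∷ʳ x) suf t eq′ y<z)))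
  where
    eq′ = trans eq (sym (++-assoc pre (x ∷ []) _))

ascent-in-first-row : ∀ {Qs x y suf} → TableauFromBottom Qs →
  concat Qs ≡ x ∷ y ∷ suf → x < y → ∃₂ λ rest above → Qs ≡ (x ∷ y ∷ rest) ∷ above
ascent-in-first-row {[]}                _ ()
ascent-in-first-row {[] ∷ _}            (() , _) _ _
ascent-in-first-row {(u ∷ []) ∷ _}      t eq   x<y with ∷-injective eq
... | refl , eq′ = ⊥-elim (<-asym x<y (above<first t eq′))
ascent-in-first-row {(u ∷ v ∷ us) ∷ Qs} _ refl _   = us , Qs , refl

-- A letter w just before z x y with x < w < z gives the K_B move w z x y ↦ w x z y.
KBFree : ℕ → ℕ → List ℕ → Set
KBFree x z pre = ∀ i w → pre ≡ i ∷ʳ w → x < w → w < z → ⊥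

KBFree-++⁻ʳ : ∀ xs {x z m} → KBFree x z (xs ++ m) → KBFree x z m
KBFree-++⁻ʳ xs kb i w refl = kb (xs ++ i) w (sym (++-assoc xs i (w ∷ [])))

¬KB⇒KBFree : ∀ pre suf {x y z} → x < y → y < z →
  ¬ KB (pre ++ z ∷ x ∷ y ∷ suf) (pre ++ x ∷ z ∷ y ∷ suf) → KBFree x z pre
¬KB⇒KBFree _ suf x<y y<z ¬kb i w refl x<w w<z =
  ¬kb (i , suf , w , _ , _ , _ , x<w , w<z , x<y , y<z ,
       inj₂ (++-assoc i (w ∷ []) _ , ++-assoc i (w ∷ []) _))

ZxyShape : List (List ℕ) → List ℕ → ℕ → ℕ → ℕ → Set
ZxyShape Q pre x y z = Linked _>_ (pre ++ z ∷ []) ×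
  ∃₂ λ rest above → Q ≡ map singletonRow pre ++ (z ∷ []) ∷ (x ∷ y ∷ rest) ∷ above

zxy-at-row-end : ∀ pre {l ls Qs x y z suf} → TableauFromBottom ((l ∷ ls) ∷ Qs) →
  x < y → KBFree x z pre → l ∷ ls ≡ pre ++ z ∷ [] → concat Qs ≡ x ∷ y ∷ suf →
  ZxyShape ((l ∷ ls) ∷ Qs) pre x y z
zxy-at-row-end pre (_ , _ , _ , tQs) x<y kb eq₁ eq₂
  with ascent-in-first-row tQs eq₂ x<y
... | rest , above , refl with initLast pre
...   | [] with eq₁
...     | refl = [-] , rest , above , refl
zxy-at-row-end _ {x = x} {z = z} (_ , lk , (x<l , _) , _) _ kb eq₁ _
  | rest , above , refl | i ∷ʳ′ w = ⊥-elim (kb i w refl x<w w<z)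
  where
    row : _ ≡ i ++ w ∷ z ∷ []
    row = trans eq₁ (++-assoc i (w ∷ []) (z ∷ []))
    w<z : w < z
    w<z = Linked-adjacent i [] (subst (Linked _<_) row lk)
    x<w : x < w
    x<w = All.head (++⁻ʳ i (subst (All (x <_)) row (Linked⇒All <-trans x<l lk)))

singleton-row-below : ∀ {l ls Qs m x y z} → TableauFromBottom ((l ∷ ls) ∷ Qs) →
  ZxyShape Qs m x y z → ZxyShape ((l ∷ ls) ∷ Qs) ((l ∷ ls) ++ m) x y z
singleton-row-below {m = []} (_ , _ , below , _) (desc , rest , above , refl)
  with below-singleton below
... | refl , z<l = z<l ∷ desc , rest , above , refl
singleton-row-below {m = _ ∷ _} (_ , _ , below , _) (desc , rest , above , refl)
  with below-singleton below
... | refl , b<l = b<l ∷ desc , rest , above , refl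

zxy-shape : ∀ Q pre suf {x y z} → TableauFromBottom Q → x < y → y < z →
  KBFree x z pre → concat Q ≡ pre ++ z ∷ x ∷ y ∷ suf → ZxyShape Q pre x y z
zxy-shape []               []      suf _ _ _ _ ()
zxy-shape []               (_ ∷ _) suf _ _ _ _ ()
zxy-shape ([] ∷ Qs)        pre     suf (() , _) _ _ _ _
zxy-shape ((l ∷ ls) ∷ Qs) pre suf t@(_ , lk , _ , tQs) x<y y<z kb eq
  with ++-split (l ∷ ls) (concat Qs) pre (_ ∷ _ ∷ suf) eq
... | inj₁ (m , refl , eq′) =
  singleton-row-below t (zxy-shape Qs m suf tQs x<y y<z (KBFree-++⁻ʳ (l ∷ ls) kb) eq′)
... | inj₂ ([] , eq₁ , eq₂) = zxy-at-row-end pre t x<y kb eq₁ (sym eq₂)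
... | inj₂ (c ∷ m , eq₁ , eq₂) with ∷-injective eq₂
...   | refl , _ =
  ⊥-elim (<-asym (<-trans x<y y<z) (Linked-adjacent pre m (subst (Linked _<_) eq₁ lk)))

reverse-++-∷-∷ : ∀ (xs : List A) y z ws → reverse (xs ++ y ∷ z ∷ ws) ≡ reverse ws ++ z ∷ y ∷ reverse xs
reverse-++-∷-∷ xs y z ws = begin
  reverse (xs ++ y ∷ z ∷ ws)               ≡⟨ reverse-++ xs (y ∷ z ∷ ws) ⟩
  (ws ʳ++ z ∷ y ∷ []) ++ reverse xs        ≡⟨ cong (_++ reverse xs) (ʳ++-defn ws) ⟩
  (reverse ws ++ z ∷ y ∷ []) ++ reverse xs ≡⟨ ++-assoc (reverse ws) (z ∷ y ∷ []) (reverse xs) ⟩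
  reverse ws ++ z ∷ y ∷ reverse xs         ∎
  where open ≡-Reasoning

shape-from-bottom : ∀ P pre x y z rest above →
  reverse P ≡ map singletonRow pre ++ (z ∷ []) ∷ (x ∷ y ∷ rest) ∷ above →
  P ≡ reverse above ++ (x ∷ y ∷ rest) ∷ (z ∷ []) ∷ map singletonRow (reverse pre)
shape-from-bottom P pre x y z rest above eq = begin
  P                   ≡⟨ reverse-involutive P ⟨
  reverse (reverse P) ≡⟨ cong reverse eq ⟩
  reverse (map singletonRow pre ++ (z ∷ []) ∷ (x ∷ y ∷ rest) ∷ above)
    ≡⟨ reverse-++-∷-∷ (map singletonRow pre) (z ∷ []) (x ∷ y ∷ rest) above ⟩
  reverse above ++ (x ∷ y ∷ rest) ∷ (z ∷ []) ∷ reverse (map singletonRow pre)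
    ≡⟨ cong (λ rows → reverse above ++ (x ∷ y ∷ rest) ∷ (z ∷ []) ∷ rows) (reverse-map singletonRow pre) ⟨
  reverse above ++ (x ∷ y ∷ rest) ∷ (z ∷ []) ∷ map singletonRow (reverse pre) ∎
  where open ≡-Reasoning

lemma7p7 : (P : Tableau) → StandardTableau P →
    (¬ (∃ λ v → K2plus (rowWord P) v)) ×
    ((pre suf : List ℕ) (x y z : ℕ) → x < y → y < z →
      rowWord P ≡ pre ++ z ∷ x ∷ y ∷ suf →
      ¬ KB (rowWord P) (pre ++ x ∷ z ∷ y ∷ suf) →
      head (rowWord P) ≢ just z →
      Linked _>_ (pre ++ z ∷ []) ×
      (∃ λ above → ∃ λ rest →
        P ≡ above ++ (x ∷ y ∷ rest) ∷ (z ∷ []) ∷ map singletonRow (reverse pre)))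
lemma7p7 P st = no-K2plus , K2minus-shape
  where
    t = reverse-tableau P st

    no-K2plus : ¬ (∃ λ v → K2plus (rowWord P) v)
    no-K2plus (_ , pre , suf , _ , _ , _ , x<y , y<z , eq , _) = no-xzy (reverse P) pre suf t x<y y<z eq

    K2minus-shape : (pre suf : List ℕ) (x y z : ℕ) → x < y → y < z →
      rowWord P ≡ pre ++ z ∷ x ∷ y ∷ suf →
      ¬ KB (rowWord P) (pre ++ x ∷ z ∷ y ∷ suf) →
      head (rowWord P) ≢ just z →
      Linked _>_ (pre ++ z ∷ []) ×
      (∃ λ above → ∃ λ rest →
        P ≡ above ++ (x ∷ y ∷ rest) ∷ (z ∷ []) ∷ map singletonRow (reverse pre))
    K2minus-shape pre suf x y z x<y y<z eq ¬kb _
      with zxy-shape (reverse P) pre suf t x<y y<z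
             (¬KB⇒KBFree pre suf x<y y<z (subst (λ w → ¬ KB w _) eq ¬kb)) eq
    ... | desc , rest , above , shape =
      desc , reverse above , rest , shape-from-bottom P pre x y z rest above shape
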